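{- Let $G=(V,E)$ be a DAG with integer netflow vector $\alpha$, and let $(G^{\mathrm{fs}},\alpha^{\mathrm{fs}})$ be its flow-supporting subgraph. Then every source $i$ of $G^{\mathrm{fs}}$ satisfies $\alpha^{\mathrm{fs}}_i>0$ and every sink $j$ of $G^{\mathrm{fs}}$ satisfies $\alpha^{\mathrm{fs}}_j<0$.
   Context: All graphs are finite. For $G=(V,E)$ and $\alpha\in\mathbb Z^V$, $\mathcal F_G(\alpha)\subseteq\mathbb R^E$ is the polytope of $F:E\to\mathbb R_{\ge0}$ with outflow minus inflow equal to $\alpha_i$ at every vertex $i$. An edge $e$ is flow-supporting if some $F\in\mathcal F_G(\alpha)$ has $F(e)>0$. The flow-supporting subgraph is $(G^{\mathrm{fs}},\alpha^{\mathrm{fs}})$ where $G^{\mathrm{fs}}=(V^{\mathrm{fs}},E^{\mathrm{fs}})$ is the subgraph of $G$ induced by the flow-supporting edges (vertex set = endpoints of these edges) and $\alpha^{\mathrm{fs}}=\alpha|_{V^{\mathrm{fs}}}$. A source (sink) has no incoming (outgoing) edges in $G^{\mathrm{fs}}$.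
   Formalization: The flows $F$ in $\mathcal F_G(\alpha)$ that determine the flow-supporting edges take values in the rationals instead of the reals. -}

module Defs where

open import Data.Nat using (ℕ; zero; suc)
open import Data.Fin using (Fin; zero; suc)
open import Data.Integer using (ℤ)
open import Data.Rational using (ℚ; 0ℚ; _+_; _-_; _/_; _≤_; _<_)
open import Data.Product using (Σ; _×_; ∃; ∃-syntax; _,_)
open import Data.Sum using (_⊎_)
open import Relation.Binary.PropositionalEquality using (_≡_)
open import Relation.Nullary using (¬_; Dec; yes; no)
open import Data.Fin using (_≟_)

record Graph (n m : ℕ) : Set where
  field
    src : Fin m → Fin n
    tgt : Fin m → Fin n
open Graph public

data Walk⁺ {n m : ℕ} (G : Graph n m) : Fin n → Fin n → Set where
  edge : (e : Fin m) → Walk⁺ G (src G e) (tgt G e)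
  _∷_  : (e : Fin m) {w : Fin n} → Walk⁺ G (tgt G e) w → Walk⁺ G (src G e) w

IsDAG : {n m : ℕ} → Graph n m → Set
IsDAG {n} G = (v : Fin n) → ¬ Walk⁺ G v v

sumFin : (k : ℕ) → (Fin k → ℚ) → ℚ
sumFin zero    f = 0ℚ
sumFin (suc k) f = f zero + sumFin k (λ i → f (suc i))

select : {n : ℕ} → Fin n → Fin n → ℚ → ℚ
select a b q with a ≟ b
... | yes _ = q
... | no  _ = 0ℚ

outflow inflow : {n m : ℕ} → Graph n m → (Fin m → ℚ) → Fin n → ℚ
outflow {m = m} G F i = sumFin m (λ e → select (src G e) i (F e))
inflow  {m = m} G F i = sumFin m (λ e → select (tgt G e) i (F e))

IsFlow : {n m : ℕ} → Graph n m → (Fin n → ℤ) → (Fin m → ℚ) → Set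
IsFlow {n} {m} G α F =
  ((e : Fin m) → 0ℚ ≤ F e) ×
  ((i : Fin n) → outflow G F i - inflow G F i ≡ (α i / 1))

FlowSupporting : {n m : ℕ} → Graph n m → (Fin n → ℤ) → Fin m → Set
FlowSupporting {m = m} G α e = Σ (Fin m → ℚ) λ F → IsFlow G α F × (0ℚ < F e)

-- Vertex set of G^fs: endpoints of flow-supporting edges.
InFS : {n m : ℕ} → Graph n m → (Fin n → ℤ) → Fin n → Set
InFS G α i = ∃[ e ] (FlowSupporting G α e × (src G e ≡ i ⊎ tgt G e ≡ i))

IsSourceFS : {n m : ℕ} → Graph n m → (Fin n → ℤ) → Fin n → Set
IsSourceFS {m = m} G α i =
  InFS G α i × ((e : Fin m) → FlowSupporting G α e → ¬ (tgt G e ≡ i))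

IsSinkFS : {n m : ℕ} → Graph n m → (Fin n → ℤ) → Fin n → Set
IsSinkFS {m = m} G α i =
  InFS G α i × ((e : Fin m) → FlowSupporting G α e → ¬ (src G e ≡ i))

αfs : {n m : ℕ} (G : Graph n m) (α : Fin n → ℤ) → (i : Fin n) → InFS G α i → ℤ
αfs G α i _ = α i

-- A source i of G^fs is an endpoint of some flow-supporting edge e, necessarily
-- the tail of e; pick a flow F with F e > 0. No edge into i is flow-supporting,
-- so every flow vanishes on those edges, and α_i = outflow_F(i) − inflow_F(i)
-- = outflow_F(i) ≥ F e > 0. Sinks are dual.
module Submission where

open import Defs
open import Data.Nat using (ℕ; zero; suc)
open import Data.Fin using (Fin; zero; suc; _≟_)
open import Data.Integer using (ℤ; 0ℤ; _<_)
import Data.Integer.Properties as ℤ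
open import Data.Rational using (ℚ; 0ℚ; _/_; -_; _-_)
import Data.Rational as ℚ
import Data.Rational.Properties as ℚ
import Data.Rational.Unnormalised as ℚᵘ
import Data.Rational.Unnormalised.Properties as ℚᵘ
open import Data.Product using (_×_; _,_; proj₁; proj₂)
open import Data.Sum using (inj₁; inj₂)
open import Data.Empty using (⊥-elim)
open import Relation.Nullary using (¬_; yes; no)
open import Relation.Binary.PropositionalEquality
  using (_≡_; _≢_; refl; sym; cong; subst; subst₂; module ≡-Reasoning)

-- i / 1 is fromℚᵘ (mkℚᵘ i 0) by definition.
/1-cancel-< : {i j : ℤ} → i / 1 ℚ.< j / 1 → i < j
/1-cancel-< {i} {j} i<j
  with ℚᵘ.*<* i*1<j*1 ← ℚᵘ.<-respˡ-≃ (ℚ.toℚᵘ-fromℚᵘ (ℚᵘ.mkℚᵘ i 0))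
                          (ℚᵘ.<-respʳ-≃ (ℚ.toℚᵘ-fromℚᵘ (ℚᵘ.mkℚᵘ j 0))
                            (ℚ.toℚᵘ-mono-< i<j))
  = subst₂ _<_ (ℤ.*-identityʳ i) (ℤ.*-identityʳ j) i*1<j*1

sumFin-nonneg : ∀ k (f : Fin k → ℚ) → (∀ e → 0ℚ ℚ.≤ f e) → 0ℚ ℚ.≤ sumFin k f
sumFin-nonneg zero    f f≥0 = ℚ.≤-refl
sumFin-nonneg (suc k) f f≥0 =
  ℚ.+-mono-≤ (f≥0 zero) (sumFin-nonneg k (λ e → f (suc e)) (λ e → f≥0 (suc e)))

sumFin-pos : ∀ k (f : Fin k → ℚ) → (∀ e → 0ℚ ℚ.≤ f e) →
             ∀ e → 0ℚ ℚ.< f e → 0ℚ ℚ.< sumFin k f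
sumFin-pos (suc k) f f≥0 zero    f0>0 =
  ℚ.+-mono-<-≤ f0>0 (sumFin-nonneg k (λ e → f (suc e)) (λ e → f≥0 (suc e)))
sumFin-pos (suc k) f f≥0 (suc e) fe>0 =
  ℚ.+-mono-≤-< (f≥0 zero) (sumFin-pos k (λ e → f (suc e)) (λ e → f≥0 (suc e)) e fe>0)

sumFin-zero : ∀ k (f : Fin k → ℚ) → (∀ e → f e ≡ 0ℚ) → sumFin k f ≡ 0ℚ
sumFin-zero zero    f f≡0 = refl
sumFin-zero (suc k) f f≡0
  rewrite f≡0 zero | sumFin-zero k (λ e → f (suc e)) (λ e → f≡0 (suc e)) = refl

module _ {n : ℕ} (a b : Fin n) (q : ℚ) where

  select-≡ : a ≡ b → select a b q ≡ q
  select-≡ a≡b with a ≟ b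
  ... | yes _  = refl
  ... | no a≢b = ⊥-elim (a≢b a≡b)

  select-nonneg : 0ℚ ℚ.≤ q → 0ℚ ℚ.≤ select a b q
  select-nonneg q≥0 with a ≟ b
  ... | yes _ = q≥0
  ... | no _  = ℚ.≤-refl

  select-zero : (a ≡ b → q ≡ 0ℚ) → select a b q ≡ 0ℚ
  select-zero q≡0 with a ≟ b
  ... | yes a≡b = q≡0 a≡b
  ... | no _    = refl

-- outflow G F and inflow G F are incidentSum (src G) F and incidentSum (tgt G) F.
incidentSum : {n m : ℕ} → (Fin m → Fin n) → (Fin m → ℚ) → Fin n → ℚ
incidentSum {m = m} end F i = sumFin m (λ e → select (end e) i (F e))

module _ {n m : ℕ} (end : Fin m → Fin n) (F : Fin m → ℚ) (i : Fin n) where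

  incidentSum-pos : (∀ e → 0ℚ ℚ.≤ F e) → ∀ e → end e ≡ i → 0ℚ ℚ.< F e →
                    0ℚ ℚ.< incidentSum end F i
  incidentSum-pos F≥0 e end≡i Fe>0 =
    sumFin-pos m _ (λ e′ → select-nonneg (end e′) i (F e′) (F≥0 e′)) e
      (subst (0ℚ ℚ.<_) (sym (select-≡ (end e) i (F e) end≡i)) Fe>0)

  incidentSum-zero : (∀ e → end e ≡ i → F e ≡ 0ℚ) → incidentSum end F i ≡ 0ℚ
  incidentSum-zero F≡0 = sumFin-zero m _ (λ e → select-zero (end e) i (F e) (F≡0 e))

module _ {n m : ℕ} (G : Graph n m) (α : Fin n → ℤ) {F : Fin m → ℚ} (flow : IsFlow G α F) where

  unsupported⇒zero : ∀ e → ¬ FlowSupporting G α e → F e ≡ 0ℚ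
  unsupported⇒zero e unsupported =
    ℚ.≤-antisym (ℚ.≮⇒≥ (λ Fe>0 → unsupported (F , flow , Fe>0))) (proj₁ flow e)

  incidentSum-unsupported : (end : Fin m → Fin n) (i : Fin n) →
    (∀ e → FlowSupporting G α e → end e ≢ i) → incidentSum end F i ≡ 0ℚ
  incidentSum-unsupported end i noSupport = incidentSum-zero end F i
    (λ e end≡i → unsupported⇒zero e (λ supported → noSupport e supported end≡i))

  netflow-without-inflow : ∀ i → inflow G F i ≡ 0ℚ → outflow G F i ≡ α i / 1
  netflow-without-inflow i in≡0 = begin
    outflow G F i                   ≡⟨ sym (ℚ.+-identityʳ (outflow G F i)) ⟩
    outflow G F i - 0ℚ              ≡⟨ cong (λ x → outflow G F i - x) (sym in≡0) ⟩
    outflow G F i - inflow G F i    ≡⟨ proj₂ flow i ⟩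
    α i / 1                         ∎
    where open ≡-Reasoning

  netflow-without-outflow : ∀ i → outflow G F i ≡ 0ℚ → - inflow G F i ≡ α i / 1
  netflow-without-outflow i out≡0 = begin
    - inflow G F i                  ≡⟨ sym (ℚ.+-identityˡ (- inflow G F i)) ⟩
    0ℚ - inflow G F i               ≡⟨ cong (λ x → x - inflow G F i) (sym out≡0) ⟩
    outflow G F i - inflow G F i    ≡⟨ proj₂ flow i ⟩
    α i / 1                         ∎
    where open ≡-Reasoning

lemma4p13 : {n m : ℕ} (G : Graph n m) (α : Fin n → ℤ) → IsDAG G →
    ((i : Fin n) (s : IsSourceFS G α i) → 0ℤ < αfs G α i (proj₁ s)) ×
    ((j : Fin n) (t : IsSinkFS G α j) → αfs G α j (proj₁ t) < 0ℤ)
lemma4p13 G α _ = source-pos , sink-neg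
  where
  source-pos : ∀ i (s : IsSourceFS G α i) → 0ℤ < αfs G α i (proj₁ s)
  source-pos i ((e , supported , inj₂ tgt≡i) , noIn) = ⊥-elim (noIn e supported tgt≡i)
  source-pos i ((e , (F , flow , Fe>0) , inj₁ src≡i) , noIn) =
    /1-cancel-< (subst (0ℚ ℚ.<_) (netflow-without-inflow G α flow i in≡0) out>0)
    where
    in≡0 : inflow G F i ≡ 0ℚ
    in≡0 = incidentSum-unsupported G α flow (tgt G) i noIn
    out>0 : 0ℚ ℚ.< outflow G F i
    out>0 = incidentSum-pos (src G) F i (proj₁ flow) e src≡i Fe>0

  sink-neg : ∀ j (t : IsSinkFS G α j) → αfs G α j (proj₁ t) < 0ℤ
  sink-neg j ((e , supported , inj₁ src≡j) , noOut) = ⊥-elim (noOut e supported src≡j)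
  sink-neg j ((e , (F , flow , Fe>0) , inj₂ tgt≡j) , noOut) =
    /1-cancel-< (subst (ℚ._< 0ℚ) (netflow-without-outflow G α flow j out≡0)
                  (ℚ.neg-antimono-< in>0))
    where
    out≡0 : outflow G F j ≡ 0ℚ
    out≡0 = incidentSum-unsupported G α flow (src G) j noOut
    in>0 : 0ℚ ℚ.< inflow G F j
    in>0 = incidentSum-pos (tgt G) F j (proj₁ flow) e tgt≡j Fe>0
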